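{- Let $r\geq 1$ and let $G$ be a graph with $\delta(G)\geq r$ and $\mathrm{girth}(G)>r+1$. Let $S\subseteq V(G)$ be an $r$-independent set of size $\alpha_r(G)$ and let $D$ be the divisor with $D(v)=0$ for $v\in S$ and $D(v)=1$ for $v\notin S$. Let $E$ be an effective divisor of degree $r$, let $C$ be a flammable component given by $D-E$, and let $d=-\min_{v\in V(C)}(D-E)(v)$. Then $C$ has at most $r-d+1$ vertices.
   Context: A graph is a finite, connected, undirected multigraph without loops; $\delta(G)$ is the minimum valence; girth is the minimum cycle length (parallel edges form a cycle of length $2$). A set $S$ is $r$-independent if graph distance $d(u,v)>r$ for all distinct $u,v\in S$; $\alpha_r(G)$ is the maximum size of such a set. A divisor is a formal integer combination $D=\sum_v D(v)(v)$, $\deg D=\sum_v D(v)$, effective if all coefficients are $\ge 0$. Flammable components: given a divisor $F$ with some negative coefficient, run the burning process: initially the burned set $B$ is $\{v: F(v)<0\}$; repeatedly, if some unburned vertex $v$ has $F(v)$ strictly less than the number of edges joining $v$ to burned vertices, add $v$ to $B$; continue until no further vertex can be added. The flammable components given by $F$ are the connected components of the induced subgraph $G[B]$ for the stabilized burned set $B$. -}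

module Defs where

open import Data.Nat using (ℕ; zero; suc; _+_; _≤_; _<_)
open import Data.Integer as ℤ using (ℤ; +_; -_; _-_; 0ℤ)
open import Data.Fin using (Fin; zero; suc; inject₁; fromℕ)
open import Data.Fin.Subset using (Subset; _∈_; _∉_; _∪_; ⁅_⁆; ∣_∣; _⊆_; Nonempty)
open import Data.Vec using (lookup; tabulate)
open import Data.Bool using (Bool; true; false; if_then_else_)
open import Data.Product using (Σ; ∃; _×_; _,_)
open import Data.Sum using (_⊎_)
open import Data.Unit using (⊤)
open import Function.Definitions using (Injective)
open import Relation.Binary.PropositionalEquality using (_≡_)
open import Relation.Nullary using (¬_; does)

sumFin : ∀ {n} → (Fin n → ℕ) → ℕ
sumFin {zero}  f = 0
sumFin {suc n} f = f zero + sumFin (λ i → f (suc i))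

sumFinℤ : ∀ {n} → (Fin n → ℤ) → ℤ
sumFinℤ {zero}  f = 0ℤ
sumFinℤ {suc n} f = f zero ℤ.+ sumFinℤ (λ i → f (suc i))

data WalkIn {n : ℕ} (adj : Fin n → Fin n → ℕ) (P : Fin n → Set)
     : ℕ → Fin n → Fin n → Set where
  here : ∀ {u} → P u → WalkIn adj P 0 u u
  step : ∀ {k u w v} → P u → 0 < adj u w → WalkIn adj P k w v →
         WalkIn adj P (suc k) u v

Walk : ∀ {n} → (Fin n → Fin n → ℕ) → ℕ → Fin n → Fin n → Set
Walk adj = WalkIn adj (λ _ → ⊤)

-- A finite, connected, undirected loopless multigraph on vertex set Fin n;
-- adj u v is the number of edges joining u and v.
record MultiGraph (n : ℕ) : Set where
  field
    adj       : Fin n → Fin n → ℕ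
    symmetric : ∀ u v → adj u v ≡ adj v u
    loopless  : ∀ v → adj v v ≡ 0
    connected : ∀ u v → ∃ λ k → Walk adj k u v
open MultiGraph public

valence : ∀ {n} → MultiGraph n → Fin n → ℕ
valence G v = sumFin (adj G v)

MinValenceAtLeast : ∀ {n} → MultiGraph n → ℕ → Set
MinValenceAtLeast G r = ∀ v → r ≤ valence G v

-- G contains a cycle of length k.  Length 2: a pair of parallel edges.
-- Length k ≥ 3: k distinct vertices, cyclically consecutive ones adjacent.
-- (Length 1 is impossible: no loops.)
HasCycleOfLength : ∀ {n} → MultiGraph n → ℕ → Set
HasCycleOfLength {n} G k =
    (k ≡ 2 × ∃ λ u → ∃ λ v → 2 ≤ adj G u v)
  ⊎ (Σ ℕ λ k' → k ≡ suc k' × 3 ≤ k ×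
       Σ (Fin (suc k') → Fin n) λ f → Injective _≡_ _≡_ f
         × (∀ (i : Fin k') → 1 ≤ adj G (f (inject₁ i)) (f (suc i)))
         × 1 ≤ adj G (f (fromℕ k')) (f zero))

-- girth(G) > g  (in particular holds if G has no cycles at all)
GirthGreaterThan : ∀ {n} → MultiGraph n → ℕ → Set
GirthGreaterThan G g = ∀ k → k ≤ g → ¬ HasCycleOfLength G k

DistAtMost : ∀ {n} → MultiGraph n → Fin n → Fin n → ℕ → Set
DistAtMost G u v r = ∃ λ k → k ≤ r × Walk (adj G) k u v

RIndependent : ∀ {n} → MultiGraph n → ℕ → Subset n → Set
RIndependent G r S = ∀ u v → u ∈ S → v ∈ S → ¬ u ≡ v → ¬ DistAtMost G u v r

MaxRIndependent : ∀ {n} → MultiGraph n → ℕ → Subset n → Set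
MaxRIndependent G r S =
  RIndependent G r S × (∀ T → RIndependent G r T → ∣ T ∣ ≤ ∣ S ∣)

Divisor : ℕ → Set
Divisor n = Fin n → ℤ

deg : ∀ {n} → Divisor n → ℤ
deg = sumFinℤ

Effective : ∀ {n} → Divisor n → Set
Effective D = ∀ v → 0ℤ ℤ.≤ D v

indicatorCompl : ∀ {n} → Subset n → Divisor n
indicatorCompl S v = if lookup S v then 0ℤ else + 1

_-ᴰ_ : ∀ {n} → Divisor n → Divisor n → Divisor n
(D -ᴰ E) v = D v - E v

edgesTo : ∀ {n} → MultiGraph n → Fin n → Subset n → ℕ
edgesTo G v B = sumFin (λ w → if lookup B w then adj G v w else 0)

negativeSet : ∀ {n} → Divisor n → Subset n
negativeSet F = tabulate (λ v → does (F v ℤ.<? 0ℤ))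

data Burns {n : ℕ} (G : MultiGraph n) (F : Divisor n) : Subset n → Set where
  start : Burns G F (negativeSet F)
  burn  : ∀ {B} v → Burns G F B → v ∉ B → F v ℤ.< + edgesTo G v B →
          Burns G F (B ∪ ⁅ v ⁆)

Stable : ∀ {n} → MultiGraph n → Divisor n → Subset n → Set
Stable G F B = ∀ v → v ∉ B → ¬ (F v ℤ.< + edgesTo G v B)

StabilizedBurnedSet : ∀ {n} → MultiGraph n → Divisor n → Subset n → Set
StabilizedBurnedSet G F B = Burns G F B × Stable G F B

-- C is (the vertex set of) a connected component of G[B]
ComponentOf : ∀ {n} → MultiGraph n → Subset n → Subset n → Set
ComponentOf G B C =
    C ⊆ B × Nonempty C
  × (∀ u v → u ∈ C → v ∈ C → ∃ λ k → WalkIn (adj G) (_∈ C) k u v)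
  × (∀ u w → u ∈ C → w ∈ B → 1 ≤ adj G u w → w ∈ C)

FlammableComponent : ∀ {n} → MultiGraph n → Divisor n → Subset n → Set
FlammableComponent G F C =
  (∃ λ v → F v ℤ.< 0ℤ) ×
  (∃ λ B → StabilizedBurnedSet G F B × ComponentOf G B C)

{-# OPTIONS --safe #-}
-- Let F = D − E, m ∈ C and d = −F(m) ≥ 1, and write W(v) = E(v) + [v ∈ S], so F = 1 − W.
-- List the vertices of C starting from m and then in the order in which they burn: each new v has
-- F(v) below its number of edges to the earlier ones, i.e. W(v) + (those edges) ≥ 2. Since
-- W(m) = d + 1, a prefix P of length k obeys 2k + d − 1 ≤ W(P) + e(P). If k ≤ r + 1, the girth
-- makes G[P] a forest and r-independence leaves at most one vertex of S in each of its components,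
-- so e(P) + |P ∩ S| ≤ k; with E(P) ≤ deg E = r this gives k ≤ r − d + 1. Taking k = min(|C|, r + 1)
-- yields |C| ≤ r − d + 1.
module Submission where

open import Defs
open import Data.Bool using (true; false; if_then_else_)
open import Data.Empty using (⊥; ⊥-elim)
open import Data.Fin using (Fin; zero; suc; inject₁; fromℕ)
import Data.Fin.Properties as Fin
open import Data.Fin.Subset using (Subset; _∈_; _∉_; ⁅_⁆; ∣_∣; _⊆_)
open import Data.Fin.Subset.Properties
  using (_∈?_; p⊆p∪q; x∈p∪q⁻; x∈⁅y⁆⇒x≡y; p⊆q⇒∣p∣≤∣q∣; ∣⁅x⁆∣≡1)
open import Data.Integer as ℤ using (ℤ; +_; -[1+_]; -_; _-_; 0ℤ; 1ℤ; +≤+; +<+)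
import Data.Integer.Properties as ℤP
import Data.Integer.Tactic.RingSolver as ℤ-Solver
open import Data.List as List using (List; []; _∷_; _++_; length; map; allFin)
open import Data.List.Properties using (map-tabulate; length-++-sucʳ)
open import Data.List.Membership.Propositional using (find; lose)
  renaming (_∈_ to _∈ₗ_; _∉_ to _∉ₗ_)
open import Data.List.Membership.Propositional.Properties
  using (∈-∃++; ∈-++⁻; ∈-++⁺ˡ; ∈-++⁺ʳ; ∈-allFin; ∈-lookup)
open import Data.List.Relation.Unary.All as All using (All; []; _∷_)
open import Data.List.Relation.Unary.All.Properties using (¬Any⇒All¬)
open import Data.List.Relation.Unary.AllPairs using ([]; _∷_)
open import Data.List.Relation.Unary.Any using (Any; here; there; any?)
open import Data.List.Relation.Unary.Linked using (Linked; []; [-]; _∷_)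
open import Data.List.Relation.Unary.Unique.Propositional using (Unique)
open import Data.List.Relation.Unary.Unique.Propositional.Properties
  using (allFin⁺; Unique[x∷xs]⇒x∉xs)
open import Data.Nat using (ℕ; zero; suc; _+_; _≤_; _<_; z≤n; s≤s; _≤?_)
open import Data.Nat.Properties
open import Data.Nat.Induction using (<-wellFounded)
open import Induction.WellFounded using (Acc; acc)
open import Algebra.Properties.CommutativeSemigroup +-commutativeSemigroup
  using (interchange; x∙yz≈y∙xz)
import Data.Nat.Tactic.RingSolver as ℕ-Solver
open import Data.Nat.ListAction using (sum)
open import Data.Product using (∃-syntax; _×_; _,_)
open import Data.Sum using (_⊎_; inj₁; inj₂; [_,_])
open import Data.Vec using (lookup; []; _∷_)
open import Data.Vec.Properties using (lookup⇒[]=; []=⇒lookup; lookup∘tabulate)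
open import Function using (_∘_; id)
open import Relation.Binary.PropositionalEquality
  using (_≡_; _≢_; refl; sym; trans; cong; cong₂; subst; module ≡-Reasoning)
open import Relation.Nullary using (¬_; Dec; yes; no)
open import Relation.Nullary.Decidable using (_×-dec_; ¬?; decidable-stable)

sumFin≡sum-tabulate : ∀ {n} (f : Fin n → ℕ) → sumFin f ≡ sum (List.tabulate f)
sumFin≡sum-tabulate {zero}  f = refl
sumFin≡sum-tabulate {suc n} f = cong (_+_ (f zero)) (sumFin≡sum-tabulate (f ∘ suc))

sumFin≡sum-allFin : ∀ {n} (f : Fin n → ℕ) → sumFin f ≡ sum (map f (allFin n))
sumFin≡sum-allFin f = trans (sumFin≡sum-tabulate f) (cong sum (sym (map-tabulate id f)))

sumFinℤ-+ : ∀ {n} {g : Fin n → ℤ} (f : Fin n → ℕ) → (∀ i → g i ≡ + f i) →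
            sumFinℤ g ≡ + sumFin f
sumFinℤ-+ {zero}  f g≡f = refl
sumFinℤ-+ {suc n} f g≡f = cong₂ ℤ._+_ (g≡f zero) (sumFinℤ-+ (f ∘ suc) (g≡f ∘ suc))

module _ {A : Set} where

  sum-map-mono : ∀ {f g : A → ℕ} → (∀ x → f x ≤ g x) → ∀ xs → sum (map f xs) ≤ sum (map g xs)
  sum-map-mono f≤g []       = z≤n
  sum-map-mono f≤g (x ∷ xs) = +-mono-≤ (f≤g x) (sum-map-mono f≤g xs)

  sum-map-+ : ∀ (f g : A → ℕ) xs →
              sum (map (λ x → f x + g x) xs) ≡ sum (map f xs) + sum (map g xs)
  sum-map-+ f g []       = refl
  sum-map-+ f g (x ∷ xs) =
    trans (cong (_+_ (f x + g x)) (sum-map-+ f g xs)) (interchange (f x) (g x) _ _)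

  sum-map-remove : ∀ (f : A → ℕ) xs y ys →
                   sum (map f (xs ++ y ∷ ys)) ≡ f y + sum (map f (xs ++ ys))
  sum-map-remove f []       y ys = refl
  sum-map-remove f (x ∷ xs) y ys =
    trans (cong (_+_ (f x)) (sum-map-remove f xs y ys)) (x∙yz≈y∙xz (f x) (f y) _)

  sum-map-const-1 : ∀ (xs : List A) → sum (map (λ _ → 1) xs) ≡ length xs
  sum-map-const-1 []       = refl
  sum-map-const-1 (x ∷ xs) = cong suc (sum-map-const-1 xs)

  ∈-remove : ∀ {z y : A} xs ys → z ∈ₗ xs ++ y ∷ ys → z ≢ y → z ∈ₗ xs ++ ys
  ∈-remove xs ys z∈ z≢y with ∈-++⁻ xs z∈
  ... | inj₁ z∈xs           = ∈-++⁺ˡ z∈xs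
  ... | inj₂ (here z≡y)     = ⊥-elim (z≢y z≡y)
  ... | inj₂ (there z∈ys)   = ∈-++⁺ʳ xs z∈ys

  All-remove : ∀ {P : A → Set} xs {y} ys → All P (xs ++ y ∷ ys) → All P (xs ++ ys)
  All-remove []       ys (_ ∷ pys)  = pys
  All-remove (x ∷ xs) ys (px ∷ pxs) = px ∷ All-remove xs ys pxs

  Unique-remove : ∀ (xs : List A) {y} ys → Unique (xs ++ y ∷ ys) → Unique (xs ++ ys)
  Unique-remove []       ys (_ ∷ u)     = u
  Unique-remove (x ∷ xs) ys (x≢ ∷ u) = All-remove xs ys x≢ ∷ Unique-remove xs ys u

  -- Each y ∈ ys with f y > 0 can be matched with its own occurrence in xs.
  sum-map-≤-of-support : ∀ (f : A → ℕ) {xs ys} → Unique ys →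
    (∀ {y} → y ∈ₗ ys → 0 < f y → y ∈ₗ xs) → sum (map f ys) ≤ sum (map f xs)
  sum-map-≤-of-support f {ys = []}     _          _    = z≤n
  sum-map-≤-of-support f {xs} {y ∷ ys} (y≢ ∷ uys) supp with f y in fy
  ... | zero  = sum-map-≤-of-support f uys (supp ∘ there)
  ... | suc k with ∈-∃++ (supp (here refl) (subst (0 <_) (sym fy) (s≤s z≤n)))
  ...   | as , bs , refl = begin
    suc k + sum (map f ys)          ≤⟨ +-monoʳ-≤ (suc k) (sum-map-≤-of-support f uys supp′) ⟩
    suc k + sum (map f (as ++ bs))  ≡⟨ cong (_+ sum (map f (as ++ bs))) fy ⟨
    f y + sum (map f (as ++ bs))    ≡⟨ sum-map-remove f as y bs ⟨
    sum (map f (as ++ y ∷ bs))      ∎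
    where
    open ≤-Reasoning
    supp′ : ∀ {z} → z ∈ₗ ys → 0 < f z → z ∈ₗ as ++ bs
    supp′ z∈ f>0 = ∈-remove as bs (supp (there z∈) f>0) (All.lookup y≢ z∈ ∘ sym)

  length-≤-of-⊆ : ∀ {xs ys : List A} → Unique ys → (∀ {y} → y ∈ₗ ys → y ∈ₗ xs) →
                  length ys ≤ length xs
  length-≤-of-⊆ {xs} {ys} uys ys⊆xs = begin
    length ys                 ≡⟨ sum-map-const-1 ys ⟨
    sum (map (λ _ → 1) ys)    ≤⟨ sum-map-≤-of-support (λ _ → 1) uys (λ y∈ _ → ys⊆xs y∈) ⟩
    sum (map (λ _ → 1) xs)    ≡⟨ sum-map-const-1 xs ⟩
    length xs                 ∎
    where open ≤-Reasoning

_∈ₗ?_ : ∀ {n} (x : Fin n) xs → Dec (x ∈ₗ xs)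
x ∈ₗ? xs = any? (x Fin.≟_) xs

sum-map≤sumFin : ∀ {n} (f : Fin n → ℕ) {ys} → Unique ys → sum (map f ys) ≤ sumFin f
sum-map≤sumFin f {ys} uys = subst (sum (map f ys) ≤_) (sym (sumFin≡sum-allFin f))
  (sum-map-≤-of-support f uys (λ _ _ → ∈-allFin _))

sumFin≤sum-map : ∀ {n} (f : Fin n → ℕ) {xs} → (∀ y → 0 < f y → y ∈ₗ xs) →
                 sumFin f ≤ sum (map f xs)
sumFin≤sum-map {n} f {xs} supp = subst (_≤ sum (map f xs)) (sym (sumFin≡sum-allFin f))
  (sum-map-≤-of-support f (allFin⁺ n) (λ {y} _ → supp y))

indicator : ∀ {n} → Subset n → Fin n → ℕ
indicator S v = if lookup S v then 1 else 0

indicator≤1 : ∀ {n} (S : Subset n) v → indicator S v ≤ 1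
indicator≤1 S v with lookup S v
... | true  = ≤-refl
... | false = z≤n

indicator-pos⇒∈ : ∀ {n} (S : Subset n) {v} → 0 < indicator S v → v ∈ S
indicator-pos⇒∈ S {v} pos with lookup S v in eq
... | true = lookup⇒[]= v S eq

∣p∣≡sumFin-indicator : ∀ {n} (S : Subset n) → ∣ S ∣ ≡ sumFin (indicator S)
∣p∣≡sumFin-indicator []          = refl
∣p∣≡sumFin-indicator (true  ∷ S) = cong suc (∣p∣≡sumFin-indicator S)
∣p∣≡sumFin-indicator (false ∷ S) = ∣p∣≡sumFin-indicator S

∣p∣≤length : ∀ {n} (S : Subset n) {P} → (∀ {v} → v ∈ S → v ∈ₗ P) → ∣ S ∣ ≤ length P
∣p∣≤length S {P} S⊆P = begin
  ∣ S ∣                      ≡⟨ ∣p∣≡sumFin-indicator S ⟩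
  sumFin (indicator S)       ≤⟨ sumFin≤sum-map (indicator S) (λ _ pos → S⊆P (indicator-pos⇒∈ S pos)) ⟩
  sum (map (indicator S) P)  ≤⟨ sum-map-mono (indicator≤1 S) P ⟩
  sum (map (λ _ → 1) P)      ≡⟨ sum-map-const-1 P ⟩
  length P                   ∎
  where open ≤-Reasoning

length<∣p∣⇒∃∉ : ∀ {n} (S : Subset n) {P} → length P < ∣ S ∣ → ∃[ c ] c ∈ S × c ∉ₗ P
length<∣p∣⇒∃∉ S {P} |P|<|S| with Fin.any? (λ c → c ∈? S ×-dec ¬? (c ∈ₗ? P))
... | yes found = found
... | no  none  = ⊥-elim (<⇒≱ |P|<|S| (∣p∣≤length S λ {c} c∈S →
                    decidable-stable (c ∈ₗ? P) (λ c∉P → none (c , c∈S , c∉P))))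

x∈p⇒1≤∣p∣ : ∀ {n} {S : Subset n} {v} → v ∈ S → 1 ≤ ∣ S ∣
x∈p⇒1≤∣p∣ {S = S} {v} v∈S = subst (_≤ ∣ S ∣) (∣⁅x⁆∣≡1 v)
  (p⊆q⇒∣p∣≤∣q∣ (λ w∈⁅v⁆ → subst (_∈ S) (sym (x∈⁅y⁆⇒x≡y v w∈⁅v⁆)) v∈S))

indicatorCompl≡1-indicator : ∀ {n} (S : Subset n) v → indicatorCompl S v ≡ 1ℤ - + indicator S v
indicatorCompl≡1-indicator S v with lookup S v
... | true  = refl
... | false = refl

∈negativeSet⇒negative : ∀ {n} (F : Divisor n) {v} → v ∈ negativeSet F → F v ℤ.< 0ℤ
∈negativeSet⇒negative F {v} v∈
  with F v ℤ.<? 0ℤ | trans (sym (lookup∘tabulate _ v)) ([]=⇒lookup v∈)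
... | yes F[v]<0 | _ = F[v]<0
... | no  _      | ()

1-m<n⇒1<n+m : ∀ m n → 1ℤ - + m ℤ.< + n → 1 < n + m
1-m<n⇒1<n+m m n 1-m<n =
  ℤP.drop‿+<+ (subst (ℤ._< + (n + m)) (cancel (+ m)) (ℤP.+-monoˡ-< (+ m) 1-m<n))
  where
  cancel : ∀ a → 1ℤ - a ℤ.+ a ≡ 1ℤ
  cancel = ℤ-Solver.solve-∀

1-m≡-[1+n]⇒m≡2+n : ∀ m n → 1ℤ - + m ≡ -[1+ n ] → m ≡ 2 + n
1-m≡-[1+n]⇒m≡2+n m n 1-m≡ = ℤP.+-injective (trans (involution (+ m)) (cong (_-_ 1ℤ) 1-m≡))
  where
  involution : ∀ a → a ≡ 1ℤ - (1ℤ - a)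
  involution = ℤ-Solver.solve-∀

c+j≤r⇒c≤r-[1+j]+1 : ∀ c r j → c + j ≤ r → + c ℤ.≤ (+ r - + suc j) ℤ.+ 1ℤ
c+j≤r⇒c≤r-[1+j]+1 c r j c+j≤r = begin
  + c                      ≡⟨ add-sub (+ c) (+ j) ⟩
  + (c + j) - + j          ≤⟨ ℤP.+-monoˡ-≤ (- + j) (+≤+ c+j≤r) ⟩
  + r - + j                ≡⟨ shift (+ r) (+ j) ⟩
  (+ r - + suc j) ℤ.+ 1ℤ   ∎
  where
  open ℤP.≤-Reasoning
  add-sub : ∀ a b → a ≡ a ℤ.+ b - b
  add-sub = ℤ-Solver.solve-∀
  shift : ∀ a b → a - b ≡ (a - (1ℤ ℤ.+ b)) ℤ.+ 1ℤ
  shift = ℤ-Solver.solve-∀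

module _ {A : Set} where

  prefixThrough : ∀ {u : A} {xs} → u ∈ₗ xs → List A
  prefixThrough {xs = x ∷ _} (here _)  = x ∷ []
  prefixThrough {xs = x ∷ _} (there q) = x ∷ prefixThrough q

  prefixThrough-⊆ : ∀ {u v : A} {xs} (q : u ∈ₗ xs) → v ∈ₗ prefixThrough q → v ∈ₗ xs
  prefixThrough-⊆ (here _)  (here v≡x) = here v≡x
  prefixThrough-⊆ (there _) (here v≡x) = here v≡x
  prefixThrough-⊆ (there q) (there v∈) = there (prefixThrough-⊆ q v∈)

  1≤length-prefixThrough : ∀ {u : A} {xs} (q : u ∈ₗ xs) → 1 ≤ length (prefixThrough q)
  1≤length-prefixThrough (here _)  = s≤s z≤n
  1≤length-prefixThrough (there _) = s≤s z≤n

  length-prefixThrough≤ : ∀ {u : A} {xs} (q : u ∈ₗ xs) → length (prefixThrough q) ≤ length xs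
  length-prefixThrough≤ (here _)  = s≤s z≤n
  length-prefixThrough≤ (there q) = s≤s (length-prefixThrough≤ q)

  prefixThrough-unique : ∀ {u : A} {xs} → Unique xs → (q : u ∈ₗ xs) → Unique (prefixThrough q)
  prefixThrough-unique _          (here _)  = [] ∷ []
  prefixThrough-unique (x≢ ∷ uxs) (there q) =
    All.tabulate (All.lookup x≢ ∘ prefixThrough-⊆ q) ∷ prefixThrough-unique uxs q

  prefixThrough-linked : ∀ {R : A → A → Set} {u xs} → Linked R xs → (q : u ∈ₗ xs) →
                         Linked R (prefixThrough q)
  prefixThrough-linked _         (here _)          = [-]
  prefixThrough-linked (x~y ∷ l) (there (here _))  = x~y ∷ [-]
  prefixThrough-linked (x~y ∷ l) (there (there q)) = x~y ∷ prefixThrough-linked l (there q)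

  prefixThrough-last : ∀ (x : A) {u xs} (q : u ∈ₗ xs) →
    List.lookup (x ∷ prefixThrough q) (fromℕ (length (prefixThrough q))) ≡ u
  prefixThrough-last x          (here u≡y) = sym u≡y
  prefixThrough-last x {xs = y ∷ _} (there q)  = prefixThrough-last y q

  lookup-injective : ∀ {xs : List A} → Unique xs →
                     ∀ {i j} → List.lookup xs i ≡ List.lookup xs j → i ≡ j
  lookup-injective (_  ∷ _)   {zero}  {zero}  _ = refl
  lookup-injective (x≢ ∷ _)   {zero}  {suc j} e = ⊥-elim (All.lookup x≢ (∈-lookup j) e)
  lookup-injective (x≢ ∷ _)   {suc i} {zero}  e = ⊥-elim (All.lookup x≢ (∈-lookup i) (sym e))
  lookup-injective (_  ∷ uxs) {suc i} {suc j} e = cong suc (lookup-injective uxs e)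

  Linked-lookup : ∀ {R : A → A → Set} {x xs} → Linked R (x ∷ xs) → ∀ (i : Fin (length xs)) →
    R (List.lookup (x ∷ xs) (inject₁ i)) (List.lookup (x ∷ xs) (suc i))
  Linked-lookup (x~y ∷ _) zero    = x~y
  Linked-lookup (_   ∷ l) (suc i) = Linked-lookup l i

module Neighbourhood {n : ℕ} (G : MultiGraph n) where

  Adjacent : Fin n → Fin n → Set
  Adjacent u v = 1 ≤ adj G u v

  Adjacent-sym : ∀ {u v} → Adjacent u v → Adjacent v u
  Adjacent-sym {u} {v} = subst (1 ≤_) (symmetric G u v)

  Adjacent⇒≢ : ∀ {u v} → Adjacent u v → u ≢ v
  Adjacent⇒≢ {u} u~u refl = 1+n≰n (subst (1 ≤_) (loopless G u) u~u)

  degreeIn : Fin n → List (Fin n) → ℕ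
  degreeIn v P = sum (map (adj G v) P)

  edgesWithin : List (Fin n) → ℕ
  edgesWithin []       = 0
  edgesWithin (x ∷ xs) = degreeIn x xs + edgesWithin xs

  degreeIn-remove-self : ∀ xs v ys → degreeIn v (xs ++ v ∷ ys) ≡ degreeIn v (xs ++ ys)
  degreeIn-remove-self xs v ys =
    trans (sum-map-remove (adj G v) xs v ys) (cong (_+ degreeIn v (xs ++ ys)) (loopless G v))

  edgesWithin-remove : ∀ xs v ys →
    edgesWithin (xs ++ v ∷ ys) ≡ degreeIn v (xs ++ ys) + edgesWithin (xs ++ ys)
  edgesWithin-remove []       v ys = refl
  edgesWithin-remove (x ∷ xs) v ys = begin
    degreeIn x (xs ++ v ∷ ys) + edgesWithin (xs ++ v ∷ ys)
      ≡⟨ cong₂ _+_ (sum-map-remove (adj G x) xs v ys) (edgesWithin-remove xs v ys) ⟩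
    (adj G x v + degreeIn x Q) + (degreeIn v Q + edgesWithin Q)
      ≡⟨ interchange (adj G x v) (degreeIn x Q) (degreeIn v Q) (edgesWithin Q) ⟩
    (adj G x v + degreeIn v Q) + (degreeIn x Q + edgesWithin Q)
      ≡⟨ cong (λ a → (a + degreeIn v Q) + (degreeIn x Q + edgesWithin Q)) (symmetric G x v) ⟩
    (adj G v x + degreeIn v Q) + (degreeIn x Q + edgesWithin Q)
      ∎
    where
    open ≡-Reasoning
    Q = xs ++ ys

  edgesTo≤degreeIn : ∀ {v} (B : Subset n) {P} → (∀ {w} → w ∈ B → Adjacent v w → w ∈ₗ P) →
                     edgesTo G v B ≤ degreeIn v P
  edgesTo≤degreeIn {v} B {P} B∩N[v]⊆P = begin
    edgesTo G v B            ≤⟨ sumFin≤sum-map toB supp ⟩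
    sum (map toB P)          ≤⟨ sum-map-mono toB≤adj P ⟩
    degreeIn v P             ∎
    where
    open ≤-Reasoning
    toB : Fin n → ℕ
    toB w = if lookup B w then adj G v w else 0
    supp : ∀ w → 0 < toB w → w ∈ₗ P
    supp w pos with lookup B w in eq
    ... | true = B∩N[v]⊆P (lookup⇒[]= w B eq) pos
    toB≤adj : ∀ w → toB w ≤ adj G v w
    toB≤adj w with lookup B w
    ... | true  = ≤-refl
    ... | false = z≤n

  neighbourIn : ∀ v P → 1 ≤ degreeIn v P → ∃[ u ] u ∈ₗ P × Adjacent v u
  neighbourIn v (x ∷ P) 1≤deg with adj G v x in e
  ... | suc _ = x , here refl , subst (1 ≤_) (sym e) (s≤s z≤n)
  ... | zero  = let u , u∈P , v~u = neighbourIn v P 1≤deg in u , there u∈P , v~u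

  anotherNeighbourIn : ∀ v {P} p → Unique P → 2 ≤ degreeIn v P →
    ∃[ u ] u ∈ₗ P × Adjacent v u × (u ≢ p ⊎ 2 ≤ adj G v u)
  anotherNeighbourIn v {x ∷ P} p (x≢ ∷ uP) 2≤deg with adj G v x in e
  ... | suc (suc _) =
    x , here refl , subst (1 ≤_) (sym e) (s≤s z≤n) , inj₂ (subst (2 ≤_) (sym e) (s≤s (s≤s z≤n)))
  ... | zero =
    let u , u∈P , v~u , u≢p⊎multiple = anotherNeighbourIn v p uP 2≤deg
    in u , there u∈P , v~u , u≢p⊎multiple
  ... | suc zero with x Fin.≟ p
  ...   | no x≢p   = x , here refl , subst (1 ≤_) (sym e) ≤-refl , inj₁ x≢p
  ...   | yes refl =
    let u , u∈P , v~u = neighbourIn v P (≤-pred 2≤deg)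
    in u , there u∈P , v~u , inj₁ (All.lookup x≢ u∈P ∘ sym)

  Linked⇒walk : ∀ {x xs} → Linked Adjacent (x ∷ xs) →
                Walk (adj G) (length xs) x (List.lookup (x ∷ xs) (fromℕ (length xs)))
  Linked⇒walk [-]       = here _
  Linked⇒walk (x~y ∷ l) = step _ x~y (Linked⇒walk l)

  walkThrough : ∀ {x u xs} → Linked Adjacent (x ∷ xs) → (q : u ∈ₗ xs) →
                Walk (adj G) (length (prefixThrough q)) x u
  walkThrough {x} l q =
    subst (Walk (adj G) _ x) (prefixThrough-last x q) (Linked⇒walk (prefixThrough-linked l (there q)))

  closedPath⇒cycle : ∀ {x xs} → Linked Adjacent (x ∷ xs) → Unique (x ∷ xs) → 2 ≤ length xs →
    Adjacent (List.lookup (x ∷ xs) (fromℕ (length xs))) x → HasCycleOfLength G (suc (length xs))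
  closedPath⇒cycle {x} {xs} l uxs 2≤ closing =
    inj₂ (length xs , refl , s≤s 2≤ , List.lookup (x ∷ xs) , lookup-injective uxs , Linked-lookup l , closing)

  chord⇒cycle : ∀ {x u xs} → Linked Adjacent (x ∷ xs) → Unique (x ∷ xs) → (q : u ∈ₗ xs) →
    2 ≤ length (prefixThrough q) → Adjacent x u → HasCycleOfLength G (suc (length (prefixThrough q)))
  chord⇒cycle {x} l uxs q 2≤ x~u =
    closedPath⇒cycle (prefixThrough-linked l (there q)) (prefixThrough-unique uxs (there q)) 2≤
      (subst (λ w → Adjacent w x) (sym (prefixThrough-last x q)) (Adjacent-sym x~u))

module Forest {n : ℕ} (G : MultiGraph n) (r : ℕ) (1≤r : 1 ≤ r) (girth : GirthGreaterThan G (r + 1))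
              (S : Subset n) (independent : RIndependent G r S) where

  open Neighbourhood G

  noCycleOfLength≤ : ∀ {k} → k ≤ suc r → ¬ HasCycleOfLength G k
  noCycleOfLength≤ {k} k≤1+r = girth k (subst (k ≤_) (+-comm 1 r) k≤1+r)

  noMultipleEdge : ∀ {u v} → ¬ (2 ≤ adj G u v)
  noMultipleEdge {u} {v} 2≤ = noCycleOfLength≤ (s≤s 1≤r) (inj₁ (refl , u , v , 2≤))

  countInS : List (Fin n) → ℕ
  countInS P = sum (map (indicator S) P)

  -- If every vertex of P were heavy, a path in G[P] starting at s could be extended forever:
  -- a neighbour of its end on the path closes a cycle of length ≤ r + 1, and an end of degree
  -- ≤ 1 in P lies in S, at distance ≤ r from s (chosen in S unless P misses S).
  module NoHeavyList (P : List (Fin n)) (uniqueP : Unique P) (|P|≤1+r : length P ≤ suc r)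
    (heavy : ∀ {v} → v ∈ₗ P → 2 ≤ degreeIn v P + indicator S v)
    (s : Fin n) (s∈P : s ∈ₗ P) (s-start : s ∈ S ⊎ (∀ {v} → v ∈ₗ P → v ∉ S)) where

    record Trail (k : ℕ) : Set where
      constructor trail
      field
        end            : Fin n
        earlier        : List (Fin n)
        length-earlier : length earlier ≡ k
        linked         : Linked Adjacent (end ∷ earlier)
        unique         : Unique (end ∷ earlier)
        within         : ∀ {v} → v ∈ₗ end ∷ earlier → v ∈ₗ P
        s∈earlier      : s ∈ₗ earlier
    open Trail

    length-trail≤ : ∀ {k} (t : Trail k) → suc (length (earlier t)) ≤ suc r
    length-trail≤ t = ≤-trans (length-≤-of-⊆ (unique t) (within t)) |P|≤1+r

    1≤degreeIn : ∀ {v} → v ∈ₗ P → 1 ≤ degreeIn v P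
    1≤degreeIn {v} v∈P = ≤-pred (begin
      2                              ≤⟨ heavy v∈P ⟩
      degreeIn v P + indicator S v   ≤⟨ +-monoʳ-≤ (degreeIn v P) (indicator≤1 S v) ⟩
      degreeIn v P + 1               ≡⟨ +-comm (degreeIn v P) 1 ⟩
      suc (degreeIn v P)             ∎)
      where open ≤-Reasoning

    degreeIn≤1⇒∈S : ∀ {v} → v ∈ₗ P → degreeIn v P ≤ 1 → v ∈ S
    degreeIn≤1⇒∈S v∈P deg≤1 =
      indicator-pos⇒∈ S (+-cancelˡ-≤ 1 1 _ (≤-trans (heavy v∈P) (+-monoˡ-≤ _ deg≤1)))

    end∉S : ∀ {k} (t : Trail k) → end t ∉ S
    end∉S t end∈S = [ (λ s∈S → independent (end t) s end∈S s∈S end≢s s-close) ,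
                      (λ P∌S → P∌S (within t (here refl)) end∈S) ] s-start
      where
      end≢s : end t ≢ s
      end≢s refl = Unique[x∷xs]⇒x∉xs (unique t) (s∈earlier t)
      s-close : DistAtMost G (end t) s r
      s-close = length (prefixThrough (s∈earlier t))
              , ≤-pred (≤-trans (s≤s (length-prefixThrough≤ (s∈earlier t))) (length-trail≤ t))
              , walkThrough (linked t) (s∈earlier t)

    end-degreeIn≥2 : ∀ {k} (t : Trail k) → 2 ≤ degreeIn (end t) P
    end-degreeIn≥2 t with 2 ≤? degreeIn (end t) P
    ... | yes 2≤deg = 2≤deg
    ... | no  2≰deg = ⊥-elim (end∉S t (degreeIn≤1⇒∈S (within t (here refl)) (≤-pred (≰⇒> 2≰deg))))

    freshNeighbour : ∀ {k} (t : Trail k) → ∃[ u ] u ∈ₗ P × u ∉ₗ end t ∷ earlier t × Adjacent (end t) u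
    freshNeighbour t@(trail x (p ∷ rest) _ linked unique _ _)
      with anotherNeighbourIn x p uniqueP (end-degreeIn≥2 t)
    ... | u , u∈P , x~u , u≢p⊎multiple with u ∈ₗ? (x ∷ p ∷ rest)
    ...   | no u∉  = u , u∈P , u∉ , x~u
    ...   | yes (here u≡x) = ⊥-elim (Adjacent⇒≢ x~u (sym u≡x))
    ...   | yes (there (here u≡p)) with u≢p⊎multiple
    ...     | inj₁ u≢p     = ⊥-elim (u≢p u≡p)
    ...     | inj₂ multiple = ⊥-elim (noMultipleEdge multiple)
    freshNeighbour t@(trail x (p ∷ rest) _ linked unique _ _)
      | u , u∈P , x~u , _ | yes (there (there q)) =
      ⊥-elim (noCycleOfLength≤
        (≤-trans (s≤s (length-prefixThrough≤ {xs = p ∷ rest} (there q))) (length-trail≤ t))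
        (chord⇒cycle linked unique (there q) (s≤s (1≤length-prefixThrough q)) x~u))

    extend : ∀ {k} → Trail k → Trail (suc k)
    extend t@(trail x earlier |earlier|≡k linked unique within s∈earlier) with freshNeighbour t
    ... | u , u∈P , u∉ , x~u =
      trail u (x ∷ earlier) (cong suc |earlier|≡k) (Adjacent-sym x~u ∷ linked) (¬Any⇒All¬ _ u∉ ∷ unique)
        (λ { (here refl) → u∈P ; (there v∈) → within v∈ }) (there s∈earlier)

    firstStep : Trail 1
    firstStep with neighbourIn s P (1≤degreeIn s∈P)
    ... | u , u∈P , s~u = trail u (s ∷ []) refl (Adjacent-sym s~u ∷ [-])
      (((Adjacent⇒≢ s~u ∘ sym) ∷ []) ∷ [] ∷ [])
      (λ { (here refl) → u∈P ; (there (here refl)) → s∈P })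
      (here refl)

    trailOfLength : ∀ k → Trail (suc k)
    trailOfLength zero    = firstStep
    trailOfLength (suc k) = extend (trailOfLength k)

    absurd : ⊥
    absurd = 1+n≰n (≤-trans (n≤1+n _) (subst (λ l → suc l ≤ length P) (length-earlier t)
                                          (length-≤-of-⊆ (unique t) (within t))))
      where t = trailOfLength (length P)

  startVertex : ∀ {P x} → x ∈ₗ P → ∃[ s ] s ∈ₗ P × (s ∈ S ⊎ (∀ {v} → v ∈ₗ P → v ∉ S))
  startVertex {P} {x} x∈P with any? (_∈? S) P
  ... | yes P∩S = let s , s∈P , s∈S = find P∩S in s , s∈P , inj₁ s∈S
  ... | no  P∌S = x , x∈P , inj₂ (λ v∈P v∈S → P∌S (lose v∈P v∈S))

  lightVertex : ∀ {P} → Unique P → length P ≤ suc r →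
                P ≡ [] ⊎ Any (λ v → degreeIn v P + indicator S v ≤ 1) P
  lightVertex {[]}        _  _       = inj₁ refl
  lightVertex {P@(_ ∷ _)} uP |P|≤1+r with any? (λ v → degreeIn v P + indicator S v ≤? 1) P
  ... | yes light = inj₂ light
  ... | no  none  =
    let s , s∈P , s-start = startVertex (here refl)
    in ⊥-elim (NoHeavyList.absurd P uP |P|≤1+r (≰⇒> ∘ All.lookup (¬Any⇒All¬ P none)) s s∈P s-start)

  edgesWithin+countInS-remove : ∀ xs v ys →
    degreeIn v (xs ++ v ∷ ys) + indicator S v ≤ 1 →
    edgesWithin (xs ++ ys) + countInS (xs ++ ys) ≤ length (xs ++ ys) →
    edgesWithin (xs ++ v ∷ ys) + countInS (xs ++ v ∷ ys) ≤ length (xs ++ v ∷ ys)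
  edgesWithin+countInS-remove xs v ys v-light IH = begin
    edgesWithin (xs ++ v ∷ ys) + countInS (xs ++ v ∷ ys)
      ≡⟨ cong₂ _+_ (edgesWithin-remove xs v ys) (sum-map-remove (indicator S) xs v ys) ⟩
    (degreeIn v Q + edgesWithin Q) + (indicator S v + countInS Q)
      ≡⟨ interchange (degreeIn v Q) (edgesWithin Q) (indicator S v) (countInS Q) ⟩
    (degreeIn v Q + indicator S v) + (edgesWithin Q + countInS Q)
      ≤⟨ +-mono-≤ (subst (λ d → d + indicator S v ≤ 1) (degreeIn-remove-self xs v ys) v-light) IH ⟩
    suc (length Q)
      ≡⟨ length-++-sucʳ xs v ys ⟨
    length (xs ++ v ∷ ys)
      ∎
    where
    open ≤-Reasoning
    Q = xs ++ ys

  -- G[P] is a forest in which each component meets S at most once.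
  edgesWithin+countInS≤length : ∀ {P} → Unique P → length P ≤ suc r →
                                edgesWithin P + countInS P ≤ length P
  edgesWithin+countInS≤length uP = byAcc (<-wellFounded _) uP
    where
    byAcc : ∀ {P} → Acc _<_ (length P) → Unique P → length P ≤ suc r →
            edgesWithin P + countInS P ≤ length P
    byAcc (acc shorter) uP |P|≤1+r with lightVertex uP |P|≤1+r
    ... | inj₁ refl  = z≤n
    ... | inj₂ light with find light
    ...   | v , v∈P , v-light with ∈-∃++ v∈P
    ...     | xs , ys , refl =
      edgesWithin+countInS-remove xs v ys v-light
        (byAcc (shorter (≤-reflexive (sym |xs++ys|+1)))
          (Unique-remove xs ys uP) (≤-trans (n≤1+n _) (subst (_≤ suc r) |xs++ys|+1 |P|≤1+r)))
      where
      |xs++ys|+1 : length (xs ++ v ∷ ys) ≡ suc (length (xs ++ ys))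
      |xs++ys|+1 = length-++-sucʳ xs v ys

module Burning {n : ℕ} (G : MultiGraph n) (F : Divisor n) (C B : Subset n)
               (C-closed : ∀ u w → u ∈ C → w ∈ B → 1 ≤ adj G u w → w ∈ C) where

  open Neighbourhood G

  -- The vertex of C outside P that burned first: its neighbours burned before it lie in C,
  -- hence in P.
  firstBurnedOutside : ∀ {A} → Burns G F A → A ⊆ B → ∀ P {c} → c ∈ A → c ∈ C → c ∉ₗ P →
                       ∃[ v ] v ∈ C × v ∉ₗ P × F v ℤ.< + degreeIn v P
  firstBurnedOutside start _ P {c} c∈A c∈C c∉P =
    c , c∈C , c∉P , ℤP.<-≤-trans (∈negativeSet⇒negative F c∈A) (+≤+ z≤n)
  firstBurnedOutside (burn {A} v burns _ F[v]<) A∪v⊆B P c∈ c∈C c∉P with x∈p∪q⁻ A ⁅ v ⁆ c∈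
  ... | inj₁ c∈A = firstBurnedOutside burns (A∪v⊆B ∘ p⊆p∪q ⁅ v ⁆) P c∈A c∈C c∉P
  ... | inj₂ c∈⁅v⁆ with x∈⁅y⁆⇒x≡y v c∈⁅v⁆
  ...   | refl with Fin.any? (λ w → w ∈? A ×-dec w ∈? C ×-dec ¬? (w ∈ₗ? P))
  ...     | yes (w , w∈A , w∈C , w∉P) =
    firstBurnedOutside burns (A∪v⊆B ∘ p⊆p∪q ⁅ v ⁆) P w∈A w∈C w∉P
  ...     | no  A∩C⊆P =
    v , c∈C , c∉P , ℤP.<-≤-trans F[v]< (+≤+ (edgesTo≤degreeIn A burnedNeighbour∈P))
    where
    burnedNeighbour∈P : ∀ {w} → w ∈ A → Adjacent v w → w ∈ₗ P
    burnedNeighbour∈P {w} w∈A v~w = decidable-stable (w ∈ₗ? P) λ w∉P →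
      A∩C⊆P (w , w∈A , C-closed v w c∈C (A∪v⊆B (p⊆p∪q ⁅ v ⁆ w∈A)) v~w , w∉P)

module Counting {n : ℕ} (G : MultiGraph n) (r : ℕ) (1≤r : 1 ≤ r) (girth : GirthGreaterThan G (r + 1))
  (S : Subset n) (independent : RIndependent G r S)
  (E : Divisor n) (E≥0 : Effective E) (deg[E]≡r : deg E ≡ + r)
  (C B : Subset n) (burns : Burns G (indicatorCompl S -ᴰ E) B) (C⊆B : C ⊆ B)
  (C-closed : ∀ u w → u ∈ C → w ∈ B → 1 ≤ adj G u w → w ∈ C)
  (m : Fin n) (m∈C : m ∈ C) where

  open Neighbourhood G
  open Forest G r 1≤r girth S independent
  open Burning G (indicatorCompl S -ᴰ E) C B C-closed

  F : Divisor n
  F = indicatorCompl S -ᴰ E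

  weight : Fin n → ℕ
  weight v = ℤ.∣ E v ∣ + indicator S v

  E≡+∣E∣ : ∀ v → E v ≡ + ℤ.∣ E v ∣
  E≡+∣E∣ v = sym (ℤP.0≤i⇒+∣i∣≡i (E≥0 v))

  F≡1-weight : ∀ v → F v ≡ 1ℤ - + weight v
  F≡1-weight v = begin
    indicatorCompl S v - E v                   ≡⟨ cong₂ _-_ (indicatorCompl≡1-indicator S v) (E≡+∣E∣ v) ⟩
    1ℤ - + indicator S v - + ℤ.∣ E v ∣          ≡⟨ reorder (+ indicator S v) (+ ℤ.∣ E v ∣) ⟩
    1ℤ - (+ ℤ.∣ E v ∣ ℤ.+ + indicator S v)      ∎
    where
    open ≡-Reasoning
    reorder : ∀ a b → 1ℤ - a - b ≡ 1ℤ - (b ℤ.+ a)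
    reorder = ℤ-Solver.solve-∀

  sum-weight≤ : ∀ {P} → Unique P → sum (map weight P) ≤ r + countInS P
  sum-weight≤ {P} uP = begin
    sum (map weight P)                    ≡⟨ sum-map-+ (ℤ.∣_∣ ∘ E) (indicator S) P ⟩
    sum (map (ℤ.∣_∣ ∘ E) P) + countInS P  ≤⟨ +-monoˡ-≤ (countInS P) (sum-map≤sumFin (ℤ.∣_∣ ∘ E) uP) ⟩
    sumFin (ℤ.∣_∣ ∘ E) + countInS P       ≡⟨ cong (_+ countInS P) sumFin∣E∣≡r ⟩
    r + countInS P                        ∎
    where
    open ≤-Reasoning
    sumFin∣E∣≡r : sumFin (ℤ.∣_∣ ∘ E) ≡ r
    sumFin∣E∣≡r = ℤP.+-injective (trans (sym (sumFinℤ-+ (ℤ.∣_∣ ∘ E) E≡+∣E∣)) deg[E]≡r)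

  module _ (j : ℕ) (F[m]≡ : F m ≡ -[1+ j ]) where

    Invariant : List (Fin n) → Set
    Invariant P = length P + length P + j ≤ sum (map weight P) + edgesWithin P

    invariant-start : Invariant (m ∷ [])
    invariant-start = ≤-reflexive (begin
      2 + j                        ≡⟨ 1-m≡-[1+n]⇒m≡2+n (weight m) j (trans (sym (F≡1-weight m)) F[m]≡) ⟨
      weight m                     ≡⟨ +-identityʳ (weight m) ⟨
      weight m + 0                 ≡⟨ +-identityʳ (weight m + 0) ⟨
      weight m + 0 + 0             ∎)
      where open ≡-Reasoning

    invariant-step : ∀ {P v} → Invariant P → 2 ≤ weight v + degreeIn v P → Invariant (v ∷ P)
    invariant-step {P} {v} inv 2≤ = begin
      suc L + suc L + j                                                 ≡⟨ regroup L j ⟩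
      2 + (L + L + j)                                                   ≤⟨ +-mono-≤ 2≤ inv ⟩
      (weight v + degreeIn v P) + (sum (map weight P) + edgesWithin P)
        ≡⟨ interchange (weight v) (degreeIn v P) (sum (map weight P)) (edgesWithin P) ⟩
      (weight v + sum (map weight P)) + (degreeIn v P + edgesWithin P)  ∎
      where
      open ≤-Reasoning
      L = length P
      regroup : ∀ l i → suc l + suc l + i ≡ 2 + (l + l + i)
      regroup = ℕ-Solver.solve-∀

    grow : ∀ k → 1 ≤ k → k ≤ ∣ C ∣ →
           ∃[ P ] length P ≡ k × Unique P × (∀ {v} → v ∈ₗ P → v ∈ C) × Invariant P
    grow (suc zero) _ _ = m ∷ [] , refl , [] ∷ [] , (λ { (here refl) → m∈C }) , invariant-start
    grow (suc (suc k)) _ k+2≤|C| with grow (suc k) (s≤s z≤n) (≤-trans (n≤1+n _) k+2≤|C|)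
    ... | P , |P|≡1+k , uP , P⊆C , inv with length<∣p∣⇒∃∉ C (subst (_< ∣ C ∣) (sym |P|≡1+k) k+2≤|C|)
    ...   | c , c∈C , c∉P with firstBurnedOutside burns id P (C⊆B c∈C) c∈C c∉P
    ...     | v , v∈C , v∉P , F[v]<deg =
      v ∷ P , cong suc |P|≡1+k , ¬Any⇒All¬ P v∉P ∷ uP ,
      (λ { (here refl) → v∈C ; (there w∈P) → P⊆C w∈P }) ,
      invariant-step {P} inv (subst (1 <_) (+-comm (degreeIn v P) (weight v))
        (1-m<n⇒1<n+m (weight v) (degreeIn v P) (subst (ℤ._< + degreeIn v P) (F≡1-weight v) F[v]<deg)))

    length+j≤r : ∀ {P} → Unique P → length P ≤ suc r → Invariant P → length P + j ≤ r
    length+j≤r {P} uP |P|≤1+r inv = +-cancelˡ-≤ L (L + j) r (begin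
      L + (L + j)                            ≡⟨ +-assoc L L j ⟨
      L + L + j                              ≤⟨ inv ⟩
      sum (map weight P) + edgesWithin P     ≤⟨ +-monoˡ-≤ (edgesWithin P) (sum-weight≤ uP) ⟩
      r + countInS P + edgesWithin P         ≡⟨ +-assoc r (countInS P) (edgesWithin P) ⟩
      r + (countInS P + edgesWithin P)       ≡⟨ cong (_+_ r) (+-comm (countInS P) (edgesWithin P)) ⟩
      r + (edgesWithin P + countInS P)       ≤⟨ +-monoʳ-≤ r (edgesWithin+countInS≤length uP |P|≤1+r) ⟩
      r + L                                  ≡⟨ +-comm r L ⟩
      L + r                                  ∎)
      where
      open ≤-Reasoning
      L = length P

    k+j≤r : ∀ k → 1 ≤ k → k ≤ ∣ C ∣ → k ≤ suc r → k + j ≤ r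
    k+j≤r k 1≤k k≤|C| k≤1+r with grow k 1≤k k≤|C|
    ... | P , refl , uP , _ , inv = length+j≤r uP k≤1+r inv

    ∣C∣+j≤r : ∣ C ∣ + j ≤ r
    ∣C∣+j≤r with ∣ C ∣ ≤? suc r
    ... | yes |C|≤1+r = k+j≤r ∣ C ∣ (x∈p⇒1≤∣p∣ m∈C) ≤-refl |C|≤1+r
    ... | no  |C|≰1+r =
      ⊥-elim (1+n≰n (m+n≤o⇒m≤o (suc r) (k+j≤r (suc r) (s≤s z≤n) (<⇒≤ (≰⇒> |C|≰1+r)) ≤-refl)))

  ∣C∣≤r-d+1 : F m ℤ.< 0ℤ → + ∣ C ∣ ℤ.≤ (+ r - (- F m)) ℤ.+ + 1
  ∣C∣≤r-d+1 F[m]<0 with F m in F[m]≡ | F[m]<0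
  ... | -[1+ j ] | _     = c+j≤r⇒c≤r-[1+j]+1 ∣ C ∣ r j (∣C∣+j≤r j F[m]≡)
  ... | + _      | +<+ ()

lemma3p2 : ∀ {n} (G : MultiGraph n) (r : ℕ) → 1 ≤ r →
    MinValenceAtLeast G r → GirthGreaterThan G (r + 1) →
    (S : Subset n) → MaxRIndependent G r S →
    (E : Divisor n) → Effective E → deg E ≡ + r →
    (C : Subset n) → FlammableComponent G (indicatorCompl S -ᴰ E) C →
    (m : Fin n) → m ∈ C →
    (∀ w → w ∈ C → (indicatorCompl S -ᴰ E) m ℤ.≤ (indicatorCompl S -ᴰ E) w) →
    + ∣ C ∣ ℤ.≤ (+ r - (- (indicatorCompl S -ᴰ E) m)) ℤ.+ + 1
lemma3p2 G r 1≤r _ girth S (independent , _) E E≥0 deg[E]≡r C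
         (_ , B , (burns , _) , C⊆B , _ , _ , C-closed) m m∈C F[m]-minimal =
  let v , v∈C , _ , F[v]<0 = Burning.firstBurnedOutside G (indicatorCompl S -ᴰ E) C B C-closed
                               burns id [] (C⊆B m∈C) m∈C (λ ())
  in Counting.∣C∣≤r-d+1 G r 1≤r girth S independent E E≥0 deg[E]≡r C B burns C⊆B C-closed m m∈C
       (ℤP.≤-<-trans (F[m]-minimal v v∈C) F[v]<0)
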